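{- Let $\mathfrak{X}$ be an association scheme of rank $4$ and diameter $2$ whose largest constituent degree is $k_3$. Fix $\varepsilon>0$ and assume $\max(k_1,k_2)\le\varepsilon k_3/2$. Then $$p^3_{1,2}\le\varepsilon k_1,\quad p^3_{1,1}\le\varepsilon k_1,\quad p^3_{2,2}\le\varepsilon k_2,$$ and $$p^1_{3,3}\ge k_3(1-\varepsilon),\quad p^2_{3,3}\ge k_3(1-\varepsilon).$$
   Context: An association scheme of rank $r$ on a finite vertex set $V$ is a surjective map $c:V\times V\to\{0,1,\dots,r-1\}$ such that $c(u,v)=0$ iff $u=v$, $c(u,v)=c(v,u)$, and for all colors $i,j,t$ there is an integer $p^t_{i,j}$ such that whenever $c(u,v)=t$ there are exactly $p^t_{i,j}$ vertices $w$ with $c(u,w)=i$, $c(w,v)=j$. The constituent $X_i$ is the graph on $V$ with distinct $u,v$ adjacent iff $c(u,v)=i$; it is regular of degree $k_i=p^0_{i,i}$. The scheme has diameter $2$ if every $X_i$ ($i\ne0$) has diameter at most $2$ and some has diameter exactly $2$.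
   Formalization: The parameter ε ranges over the positive rationals. -}

module Defs where

open import Data.Nat using (ℕ; zero; suc)
open import Data.Fin using (Fin)
open import Data.Fin.Properties using (_≟_)
open import Data.List using (length; filter)
open import Data.List.Base using (allFin)
open import Data.Product using (Σ; ∃; _×_; _,_)
open import Data.Sum using (_⊎_)
open import Relation.Binary.PropositionalEquality using (_≡_; _≢_)
open import Relation.Nullary using (¬_)
open import Relation.Nullary.Decidable using (_×-dec_)
open import Data.Integer using (+_)
open import Data.Rational using (ℚ; _/_)

toℚ : ℕ → ℚ
toℚ n = + n / 1

countPaths : {n r : ℕ} → (Fin n → Fin n → Fin r) → Fin n → Fin n → Fin r → Fin r → ℕ
countPaths {n} c u v i j =
  length (filter (λ w → (c u w ≟ i) ×-dec (c w v ≟ j)) (allFin n))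

-- association scheme of rank (suc m) on vertex set Fin n; colours are Fin (suc m)
record AssocScheme (n m : ℕ) : Set where
  field
    c       : Fin n → Fin n → Fin (suc m)
    surj    : ∀ (i : Fin (suc m)) → ∃ λ (uv : Fin n × Fin n) → c (Data.Product.proj₁ uv) (Data.Product.proj₂ uv) ≡ i
    diag    : ∀ u v → (c u v ≡ Fin.zero → u ≡ v) × (u ≡ v → c u v ≡ Fin.zero)
    sym     : ∀ u v → c u v ≡ c v u
    p       : Fin (suc m) → Fin (suc m) → Fin (suc m) → ℕ   -- p t i j = p^t_{i,j}
    p-spec  : ∀ t i j u v → c u v ≡ t → countPaths c u v i j ≡ p t i j
  k : Fin (suc m) → ℕ
  k i = p Fin.zero i i
  Adj : Fin (suc m) → Fin n → Fin n → Set
  Adj i u v = u ≢ v × c u v ≡ i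

DiamLe2 : {n : ℕ} → (Fin n → Fin n → Set) → Set
DiamLe2 {n} G = ∀ u v → u ≡ v ⊎ G u v ⊎ (∃ λ w → G u w × G w v)

DiamEq2 : {n : ℕ} → (Fin n → Fin n → Set) → Set
DiamEq2 {n} G = DiamLe2 G × (∃ λ u → ∃ λ v → u ≢ v × ¬ G u v)

HasDiameter2 : {n m : ℕ} → AssocScheme n m → Set
HasDiameter2 {n} {m} X =
  (∀ (i : Fin (suc m)) → i ≢ Fin.zero → DiamLe2 (Adj i)) × (∃ λ (i : Fin (suc m)) → i ≢ Fin.zero × DiamEq2 (Adj i))
  where open AssocScheme X

-- Counting the vertices w with c(u,w) = i and c(w,v) = j in two ways gives two standard relations:
-- summing over the v with c(u,v) = l yields k_l p^l_{ij} ≤ k_i k_j, and summing over the colour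
-- of (w,v) yields k_t = Σ_j p^l_{tj}, whose j = 0 term vanishes unless l = t. In rank 4 the first,
-- with l = 3 and k_1, k_2 ≤ εk_3/2, bounds p^3_{12}, p^3_{11}, p^3_{22}; the second, with
-- l ∈ {1,2} and t = 3, reads k_3 ≤ p^l_{31} + p^l_{32} + p^l_{33} ≤ k_1 + k_2 + p^l_{33}.
module Submission where

module Counting where

  open import Defs
  open import Data.Nat using (ℕ; zero; suc; _+_; _*_; _≤_; _<_; z≤n)
  open import Data.Nat.Properties
    using (+-*-semiring; ≤-refl; ≤-reflexive; +-mono-≤; +-identityʳ; *-identityʳ; module ≤-Reasoning)
  open import Algebra.Properties.Semiring.Sum +-*-semiring
    using (sum; sum-syntax; sum-cong-≗; sum-replicate-zero; ∑-comm; *-distribˡ-sum; *-distribʳ-sum)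
  open import Data.Bool using (true; false; if_then_else_)
  open import Data.Fin using (Fin; zero; suc; #_)
  open import Data.Fin.Properties using (_≟_)
  open import Data.List using (length; filter; tabulate; allFin)
  open import Data.List.Properties using (filter-some; filter-none)
  open import Data.List.Membership.Propositional using (lose)
  open import Data.List.Membership.Propositional.Properties using (∈-allFin)
  open import Data.List.Relation.Unary.All using (universal)
  open import Data.Product using (_×_; _,_; proj₁; proj₂)
  open import Data.Vec.Functional using (Vector)
  open import Function using (id; _∘_)
  open import Relation.Binary.PropositionalEquality
    using (_≡_; _≢_; refl; sym; trans; cong; cong₂; module ≡-Reasoning)
  open import Relation.Nullary using (Dec; does; yes; no; ¬_)
  open import Relation.Nullary.Decidable using (_×-dec_)
  open import Relation.Unary using (Pred; Decidable)

  private variable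
    A B : Set

  𝟙 : Dec A → ℕ
  𝟙 a? = if does a? then 1 else 0

  𝟙-×-dec : (a? : Dec A) (b? : Dec B) → 𝟙 (a? ×-dec b?) ≡ 𝟙 a? * 𝟙 b?
  𝟙-×-dec a? b? with does a? | does b?
  ... | true  | true  = refl
  ... | true  | false = refl
  ... | false | _     = refl

  𝟙-idem : (a? : Dec A) → 𝟙 a? * 𝟙 a? ≡ 𝟙 a?
  𝟙-idem a? with does a?
  ... | true  = refl
  ... | false = refl

  𝟙*n≤n : (a? : Dec A) (n : ℕ) → 𝟙 a? * n ≤ n
  𝟙*n≤n a? n with does a?
  ... | true  = ≤-reflexive (+-identityʳ n)
  ... | false = z≤n

  sum-mono-≤ : ∀ {n} {f g : Vector ℕ n} → (∀ i → f i ≤ g i) → sum f ≤ sum g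
  sum-mono-≤ {zero}  f≤g = z≤n
  sum-mono-≤ {suc n} f≤g = +-mono-≤ (f≤g zero) (sum-mono-≤ (f≤g ∘ suc))

  length-filter-tabulate : ∀ {n} {P : Pred A _} (P? : Decidable P) (f : Fin n → A) →
    length (filter P? (tabulate f)) ≡ ∑[ i < n ] 𝟙 (P? (f i))
  length-filter-tabulate {n = zero}  P? f = refl
  length-filter-tabulate {n = suc n} P? f with does (P? (f zero))
  ... | true  = cong suc (length-filter-tabulate P? (f ∘ suc))
  ... | false = length-filter-tabulate P? (f ∘ suc)

  length-filter-allFin : ∀ {n} {P : Pred (Fin n) _} (P? : Decidable P) →
    length (filter P? (allFin n)) ≡ ∑[ i < n ] 𝟙 (P? i)
  length-filter-allFin P? = length-filter-tabulate P? id

  ∑𝟙-≟ : ∀ {r} (x : Fin r) → ∑[ j < r ] 𝟙 (x ≟ j) ≡ 1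
  ∑𝟙-≟ {suc r} zero    = cong suc (sum-replicate-zero r)
  ∑𝟙-≟         (suc x) = ∑𝟙-≟ x

  module _ {n m : ℕ} (X : AssocScheme n m) where

    open AssocScheme X renaming (sym to c-sym)

    countPaths≡∑ : ∀ u v i j → countPaths c u v i j ≡ ∑[ w < n ] (𝟙 (c u w ≟ i) * 𝟙 (c w v ≟ j))
    countPaths≡∑ u v i j = trans (length-filter-allFin (λ w → (c u w ≟ i) ×-dec (c w v ≟ j)))
                                 (sum-cong-≗ λ w → 𝟙-×-dec (c u w ≟ i) (c w v ≟ j))

    k≡∑𝟙 : ∀ u i → k i ≡ ∑[ w < n ] 𝟙 (c u w ≟ i)
    k≡∑𝟙 u i = begin
      k i                                              ≡⟨ sym (p-spec zero i i u u (proj₂ (diag u u) refl)) ⟩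
      countPaths c u u i i                             ≡⟨ countPaths≡∑ u u i i ⟩
      ∑[ w < n ] (𝟙 (c u w ≟ i) * 𝟙 (c w u ≟ i))        ≡⟨ sum-cong-≗ diagonal ⟩
      ∑[ w < n ] 𝟙 (c u w ≟ i)                         ∎
      where
      open ≡-Reasoning
      diagonal : ∀ w → 𝟙 (c u w ≟ i) * 𝟙 (c w u ≟ i) ≡ 𝟙 (c u w ≟ i)
      diagonal w rewrite c-sym w u = 𝟙-idem (c u w ≟ i)

    p≤k : ∀ l i j → p l i j ≤ k j
    p≤k l i j with (u , v) , e ← surj l = begin
      p l i j                                          ≡⟨ sym (p-spec l i j u v e) ⟩
      countPaths c u v i j                             ≡⟨ countPaths≡∑ u v i j ⟩
      ∑[ w < n ] (𝟙 (c u w ≟ i) * 𝟙 (c w v ≟ j))        ≤⟨ sum-mono-≤ (λ w → 𝟙*n≤n (c u w ≟ i) _) ⟩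
      ∑[ w < n ] 𝟙 (c w v ≟ j)                         ≡⟨ sum-cong-≗ (λ w → cong (λ x → 𝟙 (x ≟ j)) (c-sym w v)) ⟩
      ∑[ w < n ] 𝟙 (c v w ≟ j)                         ≡⟨ sym (k≡∑𝟙 v j) ⟩
      k j                                              ∎
      where open ≤-Reasoning

    𝟙*p≤countPaths : ∀ u v l i j → 𝟙 (c u v ≟ l) * p l i j ≤ countPaths c u v i j
    𝟙*p≤countPaths u v l i j with c u v ≟ l
    ... | yes e = ≤-reflexive (trans (+-identityʳ (p l i j)) (sym (p-spec l i j u v e)))
    ... | no _  = z≤n

    k*p≤k*k : ∀ l i j → k l * p l i j ≤ k i * k j
    k*p≤k*k l i j with (u , _) , _ ← surj l = begin
      k l * p l i j                                    ≡⟨ cong (_* p l i j) (k≡∑𝟙 u l) ⟩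
      (∑[ v < n ] 𝟙 (c u v ≟ l)) * p l i j             ≡⟨ *-distribʳ-sum (p l i j) (λ v → 𝟙 (c u v ≟ l)) ⟩
      ∑[ v < n ] (𝟙 (c u v ≟ l) * p l i j)             ≤⟨ sum-mono-≤ (λ v → 𝟙*p≤countPaths u v l i j) ⟩
      ∑[ v < n ] countPaths c u v i j                  ≡⟨ sum-cong-≗ (λ v → countPaths≡∑ u v i j) ⟩
      ∑[ v < n ] ∑[ w < n ] (𝟙 (c u w ≟ i) * 𝟙 (c w v ≟ j))
        ≡⟨ ∑-comm (λ v w → 𝟙 (c u w ≟ i) * 𝟙 (c w v ≟ j)) ⟩
      ∑[ w < n ] ∑[ v < n ] (𝟙 (c u w ≟ i) * 𝟙 (c w v ≟ j))
        ≡⟨ sum-cong-≗ (λ w → sym (*-distribˡ-sum (𝟙 (c u w ≟ i)) (λ v → 𝟙 (c w v ≟ j)))) ⟩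
      ∑[ w < n ] (𝟙 (c u w ≟ i) * ∑[ v < n ] 𝟙 (c w v ≟ j))
        ≡⟨ sum-cong-≗ (λ w → cong (𝟙 (c u w ≟ i) *_) (sym (k≡∑𝟙 w j))) ⟩
      ∑[ w < n ] (𝟙 (c u w ≟ i) * k j)                 ≡⟨ sym (*-distribʳ-sum (k j) (λ w → 𝟙 (c u w ≟ i))) ⟩
      (∑[ w < n ] 𝟙 (c u w ≟ i)) * k j                 ≡⟨ cong (_* k j) (sym (k≡∑𝟙 u i)) ⟩
      k i * k j                                        ∎
      where open ≤-Reasoning

    ∑p≡k : ∀ l t → ∑[ j < suc m ] p l t j ≡ k t
    ∑p≡k l t with (u , v) , e ← surj l = begin
      ∑[ j < suc m ] p l t j                           ≡⟨ sum-cong-≗ (λ j → sym (p-spec l t j u v e)) ⟩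
      ∑[ j < suc m ] countPaths c u v t j              ≡⟨ sum-cong-≗ (countPaths≡∑ u v t) ⟩
      ∑[ j < suc m ] ∑[ w < n ] (𝟙 (c u w ≟ t) * 𝟙 (c w v ≟ j))
        ≡⟨ ∑-comm (λ j w → 𝟙 (c u w ≟ t) * 𝟙 (c w v ≟ j)) ⟩
      ∑[ w < n ] ∑[ j < suc m ] (𝟙 (c u w ≟ t) * 𝟙 (c w v ≟ j))
        ≡⟨ sum-cong-≗ (λ w → sym (*-distribˡ-sum (𝟙 (c u w ≟ t)) (λ j → 𝟙 (c w v ≟ j)))) ⟩
      ∑[ w < n ] (𝟙 (c u w ≟ t) * ∑[ j < suc m ] 𝟙 (c w v ≟ j))
        ≡⟨ sum-cong-≗ (λ w → cong (𝟙 (c u w ≟ t) *_) (∑𝟙-≟ (c w v))) ⟩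
      ∑[ w < n ] (𝟙 (c u w ≟ t) * 1)                   ≡⟨ sum-cong-≗ (λ w → *-identityʳ (𝟙 (c u w ≟ t))) ⟩
      ∑[ w < n ] 𝟙 (c u w ≟ t)                         ≡⟨ sym (k≡∑𝟙 u t) ⟩
      k t                                              ∎
      where open ≡-Reasoning

    p-zeroʳ : ∀ {l t} → l ≢ t → p l t zero ≡ 0
    p-zeroʳ {l} {t} l≢t with (u , v) , e ← surj l = begin
      p l t zero                                       ≡⟨ sym (p-spec l t zero u v e) ⟩
      countPaths c u v t zero
        ≡⟨ cong length (filter-none (λ w → (c u w ≟ t) ×-dec (c w v ≟ zero)) (universal no-path (allFin n))) ⟩
      0                                                ∎
      where
      open ≡-Reasoning
      no-path : ∀ w → ¬ (c u w ≡ t × c w v ≡ zero)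
      no-path w (cuw≡t , cwv≡0) with refl ← proj₁ (diag w v) cwv≡0 = l≢t (trans (sym e) cuw≡t)

    k-pos : ∀ t → 0 < k t
    k-pos t with (u , v) , e ← surj t = begin-strict
      0
        <⟨ filter-some (λ w → (c u w ≟ t) ×-dec (c w u ≟ t)) (lose (∈-allFin v) (e , trans (c-sym v u) e)) ⟩
      countPaths c u u t t                             ≡⟨ p-spec zero t t u u (proj₂ (diag u u) refl) ⟩
      k t                                              ∎
      where open ≤-Reasoning

  module _ {n : ℕ} (X : AssocScheme n 3) where

    open AssocScheme X using (k; p)

    k₃≤k₁+k₂+p : ∀ l → l ≢ # 3 → k (# 3) ≤ k (# 1) + (k (# 2) + p l (# 3) (# 3))
    k₃≤k₁+k₂+p l l≢3 = begin
      k (# 3)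
        ≡⟨ sym (∑p≡k X l (# 3)) ⟩
      p l (# 3) (# 0) + (p l (# 3) (# 1) + (p l (# 3) (# 2) + (p l (# 3) (# 3) + 0)))
        ≡⟨ cong₂ _+_ (p-zeroʳ X l≢3) (cong (λ x → p l (# 3) (# 1) + (p l (# 3) (# 2) + x)) (+-identityʳ _)) ⟩
      p l (# 3) (# 1) + (p l (# 3) (# 2) + p l (# 3) (# 3))
        ≤⟨ +-mono-≤ (p≤k X l (# 3) (# 1)) (+-mono-≤ (p≤k X l (# 3) (# 2)) ≤-refl) ⟩
      k (# 1) + (k (# 2) + p l (# 3) (# 3))
        ∎
      where open ≤-Reasoning

module RationalBounds where

  open import Defs
  import Data.Nat as ℕ
  open import Data.Nat.Coprimality using (1-coprimeTo)
  import Data.Nat.Coprimality as Coprimality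
  open import Data.Integer using (+_; +≤+; +<+)
  import Data.Integer.Properties as ℤ
  open import Data.Rational
  open import Data.Rational.Properties
  open import Data.Rational.Solver using (module +-*-Solver)
  open import Relation.Binary.PropositionalEquality using (_≡_; refl; sym; trans; cong; cong₂; subst₂)

  toℚ≡mkℚ : ∀ x → toℚ x ≡ mkℚ (+ x) 0 (Coprimality.sym (1-coprimeTo x))
  toℚ≡mkℚ x = normalize-coprime (Coprimality.sym (1-coprimeTo x))

  toℚ-mono-≤ : ∀ {x y} → x ℕ.≤ y → toℚ x ≤ toℚ y
  toℚ-mono-≤ {x} {y} x≤y rewrite toℚ≡mkℚ x | toℚ≡mkℚ y =
    *≤* (subst₂ Data.Integer._≤_ (sym (ℤ.*-identityʳ (+ x))) (sym (ℤ.*-identityʳ (+ y))) (+≤+ x≤y))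

  toℚ-+ : ∀ x y → toℚ (x ℕ.+ y) ≡ toℚ x + toℚ y
  toℚ-+ x y rewrite toℚ≡mkℚ x | toℚ≡mkℚ y =
    cong (_/ 1) (trans (ℤ.pos-+ x y) (sym (cong₂ Data.Integer._+_ (ℤ.*-identityʳ (+ x)) (ℤ.*-identityʳ (+ y)))))

  toℚ-* : ∀ x y → toℚ (x ℕ.* y) ≡ toℚ x * toℚ y
  toℚ-* x y rewrite toℚ≡mkℚ x | toℚ≡mkℚ y = cong (_/ 1) (ℤ.pos-* x y)

  toℚ-pos : ∀ {x} → 0 ℕ.< x → Positive (toℚ x)
  toℚ-pos x>0 = positive (<-≤-trans (*<* (+<+ (ℕ.s≤s ℕ.z≤n))) (toℚ-mono-≤ x>0))

  toℚ-nonNeg : ∀ x → NonNegative (toℚ x)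
  toℚ-nonNeg x = nonNegative (toℚ-mono-≤ {0} {x} ℕ.z≤n)

  *½-≤ : ∀ q → .{{NonNegative q}} → q * ½ ≤ q
  *½-≤ q = ≤-trans (*-monoˡ-≤-nonNeg q (*≤* (+≤+ (ℕ.s≤s ℕ.z≤n)))) (≤-reflexive (*-identityʳ q))

  ε-bound-via-product : ∀ ε a b p {t} → 0 ℕ.< t → 0ℚ < ε →
    t ℕ.* p ℕ.≤ a ℕ.* b → toℚ b ≤ ε * toℚ t * ½ → toℚ p ≤ ε * toℚ a
  ε-bound-via-product ε a b p {t} t>0 ε>0 tp≤ab b≤εt/2 =
    *-cancelˡ-≤-pos (toℚ t) {{t-pos}} (begin
      toℚ t * toℚ p       ≡⟨ toℚ-* t p ⟨
      toℚ (t ℕ.* p)       ≤⟨ toℚ-mono-≤ tp≤ab ⟩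
      toℚ (a ℕ.* b)       ≡⟨ toℚ-* a b ⟩
      toℚ a * toℚ b       ≤⟨ *-monoˡ-≤-nonNeg (toℚ a) {{toℚ-nonNeg a}} b≤εt ⟩
      toℚ a * (ε * toℚ t) ≡⟨ solve 3 (λ a t ε → a :* (ε :* t) := t :* (ε :* a)) refl (toℚ a) (toℚ t) ε ⟩
      toℚ t * (ε * toℚ a) ∎)
    where
    open ≤-Reasoning
    open +-*-Solver
    t-pos : Positive (toℚ t)
    t-pos = toℚ-pos t>0
    εt-nonNeg : NonNegative (ε * toℚ t)
    εt-nonNeg = pos⇒nonNeg (ε * toℚ t) {{pos*pos⇒pos ε {{positive ε>0}} (toℚ t) {{t-pos}}}}
    b≤εt : toℚ b ≤ ε * toℚ t
    b≤εt = ≤-trans b≤εt/2 (*½-≤ (ε * toℚ t) {{εt-nonNeg}})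

  1-ε-bound-via-sum : ∀ ε a b p {t} → t ℕ.≤ a ℕ.+ (b ℕ.+ p) →
    toℚ a ≤ ε * toℚ t * ½ → toℚ b ≤ ε * toℚ t * ½ → toℚ t * (1ℚ - ε) ≤ toℚ p
  1-ε-bound-via-sum ε a b p {t} t≤a+b+p a≤εt/2 b≤εt/2 = begin
    toℚ t * (1ℚ - ε)
      ≡⟨ solve 2 (λ t ε → t :* (con 1ℚ :- ε) := t :- ε :* t) refl (toℚ t) ε ⟩
    toℚ t - ε * toℚ t
      ≤⟨ +-monoˡ-≤ (- (ε * toℚ t)) (toℚ-mono-≤ t≤a+b+p) ⟩
    toℚ (a ℕ.+ (b ℕ.+ p)) - ε * toℚ t
      ≡⟨ cong (_- ε * toℚ t) (trans (toℚ-+ a (b ℕ.+ p)) (cong (λ q → toℚ a + q) (toℚ-+ b p))) ⟩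
    toℚ a + (toℚ b + toℚ p) - ε * toℚ t
      ≤⟨ +-monoˡ-≤ (- (ε * toℚ t)) (+-mono-≤ a≤εt/2 (+-monoˡ-≤ (toℚ p) b≤εt/2)) ⟩
    ε * toℚ t * ½ + (ε * toℚ t * ½ + toℚ p) - ε * toℚ t
      ≡⟨ solve 3 (λ t ε p → ε :* t :* con ½ :+ (ε :* t :* con ½ :+ p) :- ε :* t := p) refl (toℚ t) ε (toℚ p) ⟩
    toℚ p
      ∎
    where
    open ≤-Reasoning
    open +-*-Solver

open import Defs
open import Data.Nat using (ℕ) renaming (_≤_ to _ℕ≤_; _<_ to _ℕ<_)
open import Data.Fin using (#_)
open import Data.Product using (_×_; _,_)
open import Data.Rational using (ℚ; _≤_; _<_; _*_; _-_; ½; 0ℚ; 1ℚ)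
open Counting using (k*p≤k*k; k₃≤k₁+k₂+p; k-pos)
open RationalBounds using (ε-bound-via-product; 1-ε-bound-via-sum)

lemma4p3 : (n : ℕ) (X : AssocScheme n 3) → HasDiameter2 X →
  AssocScheme.k X (# 1) ℕ≤ AssocScheme.k X (# 3) → AssocScheme.k X (# 2) ℕ≤ AssocScheme.k X (# 3) →
  (ε : ℚ) → 0ℚ < ε →
  toℚ (AssocScheme.k X (# 1)) ≤ ε * toℚ (AssocScheme.k X (# 3)) * ½ →
  toℚ (AssocScheme.k X (# 2)) ≤ ε * toℚ (AssocScheme.k X (# 3)) * ½ →
  (toℚ (AssocScheme.p X (# 3) (# 1) (# 2)) ≤ ε * toℚ (AssocScheme.k X (# 1)))
  × (toℚ (AssocScheme.p X (# 3) (# 1) (# 1)) ≤ ε * toℚ (AssocScheme.k X (# 1)))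
  × (toℚ (AssocScheme.p X (# 3) (# 2) (# 2)) ≤ ε * toℚ (AssocScheme.k X (# 2)))
  × (toℚ (AssocScheme.k X (# 3)) * (1ℚ - ε) ≤ toℚ (AssocScheme.p X (# 1) (# 3) (# 3)))
  × (toℚ (AssocScheme.k X (# 3)) * (1ℚ - ε) ≤ toℚ (AssocScheme.p X (# 2) (# 3) (# 3)))
lemma4p3 _ X _ _ _ ε ε>0 k₁≤εk₃/2 k₂≤εk₃/2 =
  ε-bound-via-product ε k₁ k₂ (p (# 3) (# 1) (# 2)) k₃>0 ε>0 (k*p≤k*k X (# 3) (# 1) (# 2)) k₂≤εk₃/2 ,
  ε-bound-via-product ε k₁ k₁ (p (# 3) (# 1) (# 1)) k₃>0 ε>0 (k*p≤k*k X (# 3) (# 1) (# 1)) k₁≤εk₃/2 ,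
  ε-bound-via-product ε k₂ k₂ (p (# 3) (# 2) (# 2)) k₃>0 ε>0 (k*p≤k*k X (# 3) (# 2) (# 2)) k₂≤εk₃/2 ,
  1-ε-bound-via-sum ε k₁ k₂ (p (# 1) (# 3) (# 3)) (k₃≤k₁+k₂+p X (# 1) (λ ())) k₁≤εk₃/2 k₂≤εk₃/2 ,
  1-ε-bound-via-sum ε k₁ k₂ (p (# 2) (# 3) (# 3)) (k₃≤k₁+k₂+p X (# 2) (λ ())) k₁≤εk₃/2 k₂≤εk₃/2
  where
  open AssocScheme X using (k; p)
  k₁ k₂ : ℕ
  k₁ = k (# 1)
  k₂ = k (# 2)
  k₃>0 : 0 ℕ< k (# 3)
  k₃>0 = k-pos X (# 3)
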